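{- Let $f$ be a closure operator on a finite set $E$ and let $F$ be a proper flat of $f$. Then $$\mathrm{link}_{\Delta_f}(x_F)\cong \Delta_{f|_F}\ast\widetilde{\Delta}_{f/F},$$ i.e. the link of $x_F$ in the augmented Bergman complex of $f$ is isomorphic to the join of the augmented Bergman complex of the restriction $f|_F$ with the Bergman complex of the contraction $f/F$.
   Context: A closure operator on a finite set $E$ is a map $f:2^E\to 2^E$ with $A\subseteq f(A)$, $A\subseteq B\Rightarrow f(A)\subseteq f(B)$, and $f(f(A))=f(A)$. A flat is a set $F$ with $f(F)=F$; proper means $F\neq E$. A set $I$ is independent if $f(I\setminus\{i\})\subsetneq f(I)$ for all $i\in I$. For a closure operator $g$ on a ground set $S$: the Bergman complex $\widetilde{\Delta}_g$ has a vertex $x_G$ for each flat $G$ with $g(\emptyset)\subsetneq G\subsetneq S$ and faces $\{x_{G_1},\dots,x_{G_\ell}\}$ for chains $g(\emptyset)\subsetneq G_1\subsetneq\cdots\subsetneq G_\ell\subsetneq S$ of flats. The augmented Bergman complex $\Delta_g$ has vertex set $\{y_i\mid i\in S\}\sqcup\{x_G\mid G\text{ a proper flat of } g\}$ and faces $\{y_i\mid i\in I\}\sqcup\{x_{G_1},\dots,x_{G_\ell}\}$ with $I$ independent and $g(I)\subseteq G_1\subsetneq\cdots\subsetneq G_\ell\subsetneq S$ flats ($\ell\ge 0$). For a flat $F$ of $f$: the contraction $f/F:2^{E\setminus F}\to2^{E\setminus F}$ is $(f/F)(A)=f(A\cup F)\setminus F$, and the restriction $f|_F:2^F\to 2^F$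 is $(f|_F)(A)=f(A)$. The link of a vertex $v$ in $\Delta$ is $\{\tau\setminus\{v\}\mid v\in\tau\in\Delta\}$, and the join of complexes $\Delta,\Gamma$ on disjoint vertex sets is $\{\sigma\cup\tau\mid\sigma\in\Delta,\tau\in\Gamma\}$. -}

module Defs where

open import Data.Nat using (ℕ)
open import Data.Bool using (Bool; true; false; not; _∧_; if_then_else_)
open import Data.Fin using (Fin)
import Data.Fin as Fin
open import Data.Fin.Subset using (Subset; _∈_; _⊆_; _⊂_; _∪_; _∩_; ∁; _-_) renaming (⊥ to ∅ˢ)
open import Data.Vec using (tabulate)
import Data.Vec.Properties as VecP
import Data.Bool.Properties as BoolP
open import Data.Sum using (_⊎_; inj₁; inj₂; [_,_])
import Data.Sum.Properties as SumP
open import Data.Product using (Σ; ∃; _×_; _,_)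
open import Relation.Nullary using (¬_; does)
open import Relation.Binary.PropositionalEquality using (_≡_; _≢_)
open import Relation.Binary.Definitions using (DecidableEquality)
open import Function.Bundles using (_⇔_)

-- Closure operators on a ground set S ⊆ Fin n.
-- A map g : 2^S → 2^S is represented by g : Subset n → Subset n,
-- of which only the values on subsets A ⊆ S matter.

record IsClosureOn {n : ℕ} (S : Subset n) (g : Subset n → Subset n) : Set where
  field
    closed     : ∀ A → A ⊆ S → g A ⊆ S
    extensive  : ∀ A → A ⊆ S → A ⊆ g A
    monotone   : ∀ A B → A ⊆ S → B ⊆ S → A ⊆ B → g A ⊆ g B
    idempotent : ∀ A → A ⊆ S → g (g A) ≡ g A

IsFlat : {n : ℕ} → Subset n → (Subset n → Subset n) → Subset n → Set
IsFlat S g G = G ⊆ S × g G ≡ G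

IsProperFlat : {n : ℕ} → Subset n → (Subset n → Subset n) → Subset n → Set
IsProperFlat S g G = IsFlat S g G × G ≢ S

IsIndependent : {n : ℕ} → Subset n → (Subset n → Subset n) → Subset n → Set
IsIndependent S g I = I ⊆ S × (∀ i → i ∈ I → g (I - i) ⊂ g I)

restrict : {n : ℕ} → (Subset n → Subset n) → Subset n → (Subset n → Subset n)
restrict f F A = f A

contract : {n : ℕ} → (Subset n → Subset n) → Subset n → (Subset n → Subset n)
contract f F A = f (A ∪ F) ∩ ∁ F

-- Abstract simplicial complexes: a vertex type with decidable equality,
-- and a predicate on finite sets of vertices (characteristic functions).

record Complex : Set₁ where
  field
    V    : Set
    decV : DecidableEquality V
    Face : (V → Bool) → Set

open Complex public

singleton : (K : Complex) → V K → (V K → Bool)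
singleton K v w = does (decV K v w)

IsVertex : (K : Complex) → V K → Set
IsVertex K v = Face K (singleton K v)

Supported : (K : Complex) → (V K → Bool) → Set
Supported K σ = ∀ v → σ v ≡ true → IsVertex K v

_≅_ : Complex → Complex → Set
K ≅ L =
  Σ (V K → V L) λ φ → Σ (V L → V K) λ ψ →
    (∀ v → IsVertex K v → IsVertex L (φ v) × ψ (φ v) ≡ v) ×
    (∀ w → IsVertex L w → IsVertex K (ψ w) × φ (ψ w) ≡ w) ×
    (∀ (σ : V K → Bool) (τ : V L → Bool) → Supported K σ → Supported L τ →
       (∀ v → IsVertex K v → σ v ≡ τ (φ v)) →
       (Face K σ ⇔ Face L τ))

link : (K : Complex) → V K → Complex
link K v = record
  { V = V K
  ; decV = decV K
  ; Face = λ ρ → ∃ λ τ → Face K τ × τ v ≡ true ×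
                   (∀ w → ρ w ≡ (τ w ∧ not (singleton K v w)))
  }

join : Complex → Complex → Complex
join K L = record
  { V = V K ⊎ V L
  ; decV = SumP.≡-dec (decV K) (decV L)
  ; Face = λ ρ → Σ (V K → Bool) λ σ → Σ (V L → Bool) λ τ →
                   Face K σ × Face L τ × (∀ x → ρ x ≡ [ σ , τ ] x)
  }

decSubset : {n : ℕ} → DecidableEquality (Subset n)
decSubset = VecP.≡-dec BoolP._≟_

IsChain : {n : ℕ} → (Subset n → Bool) → Set
IsChain {n} c = ∀ G H → c G ≡ true → c H ≡ true → G ⊆ H ⊎ H ⊆ G

Bergman : {n : ℕ} → Subset n → (Subset n → Subset n) → Complex
Bergman {n} S g = record
  { V = Subset n
  ; decV = decSubset
  ; Face = λ c → (∀ G → c G ≡ true → IsFlat S g G × g ∅ˢ ⊂ G × G ⊂ S)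
                 × IsChain c
  }

-- augmented Bergman complex: vertices y_i = inj₁ i (i ∈ S) and
-- x_G = inj₂ G (G a proper flat); faces {y_i | i ∈ I} ∪ {x_G₁,…,x_G_ℓ}
-- with I independent and g(I) ⊆ G₁ ⊊ ⋯ ⊊ G_ℓ ⊊ S flats.
AugBergman : {n : ℕ} → Subset n → (Subset n → Subset n) → Complex
AugBergman {n} S g = record
  { V = Fin n ⊎ Subset n
  ; decV = SumP.≡-dec Fin._≟_ decSubset
  ; Face = λ σ →
      let I = tabulate (λ i → σ (inj₁ i)) in
      IsIndependent S g I ×
      (∀ G → σ (inj₂ G) ≡ true → IsProperFlat S g G × g I ⊆ G) ×
      IsChain (λ G → σ (inj₂ G))
  }

{-# OPTIONS --safe #-}
-- A face of the augmented Bergman complex through x_F is an independent set I with f(I) ⊆ F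
-- together with a chain of flats passing through F.  Cutting the chain at F leaves a chain of
-- proper flats of f|_F, which together with I is a face of Δ_{f|F}, and a chain of flats
-- strictly above F.  The latter are exactly the proper non-minimal flats of f/F, via G ↦ G ∖ F
-- with inverse H ↦ H ∪ F; the minimal flat (f/F)(∅) is empty because F is closed.
module Submission where

open import Defs
open import Data.Nat using (ℕ)
open import Data.Sum using (inj₂)
open import Data.Fin.Subset using (Subset; ⊤; ∁)
open import Relation.Binary.PropositionalEquality using (_≢_)

open import Data.Bool using (Bool; true; false; not; _∨_; _∧_)
open import Data.Bool.Properties using (∧-identityʳ; ∨-zeroʳ)
open import Data.Empty using (⊥-elim)
open import Data.Fin using (Fin)
import Data.Fin as Fin
open import Data.Fin.Properties using (any?)
open import Data.Fin.Subset using (_∈_; _∉_; _⊆_; _⊂_; _∪_; _∩_; _─_; _-_; ⁅_⁆) renaming (⊥ to ∅ˢ)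
open import Data.Fin.Subset.Properties
  using (_∈?_; _⊆?_; ∈⊤; ⊆⊤; ⊥⊆; ∉⊥; x∈⁅x⁆; ⊆-refl; ⊆-reflexive; ⊆-trans; ⊆-antisym; p─q⊆p; p∩q⊆q; q⊆p∪q;
         x∈p∧x≢y⇒x∈p-y; x∈p∩q⁺; x∈p∩q⁻; x∈p∪q⁺; x∈p∪q⁻; x∈∁p⇒x∉p; x∉p⇒x∈∁p; p∪∁p≡⊤; ∪-identityˡ; ∩-inverseʳ)
open import Data.Product using (∃; _×_; _,_; proj₁; proj₂; map₂)
open import Data.Sum using (_⊎_; inj₁; [_,_])
open import Data.Sum.Properties using (inj₁-injective; inj₂-injective)
import Data.Sum as Sum
open import Data.Vec using (_∷_; tabulate; there)
open import Data.Vec.Properties using (tabulate-cong; lookup∘tabulate; []=⇒lookup; lookup⇒[]=)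
open import Function using (_∘_; id)
open import Function.Bundles using (_⇔_; mk⇔; Equivalence)
open import Function.Construct.Composition using (_⇔-∘_)
open import Relation.Nullary using (¬_; Dec; yes; no; does; contradiction)
open import Relation.Nullary.Decidable using (dec-true; dec-false; decidable-stable; ¬?; _×-dec_)
open import Relation.Binary.PropositionalEquality using (_≡_; refl; sym; trans; cong; cong₂; subst; module ≡-Reasoning)

open Equivalence using (to; from)

does-true⇒ : ∀ {a} {A : Set a} (a? : Dec A) → does a? ≡ true → A
does-true⇒ (yes a) _ = a

≢true⇒≡false : ∀ {b} → ¬ b ≡ true → b ≡ false
≢true⇒≡false {false} _ = refl
≢true⇒≡false {true} b≢true = contradiction refl b≢true

true⇔true⇒≡ : ∀ {a b : Bool} → (a ≡ true → b ≡ true) → (b ≡ true → a ≡ true) → a ≡ b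
true⇔true⇒≡ {false} {false} _ _ = refl
true⇔true⇒≡ {false} {true} _ b⇒a = b⇒a refl
true⇔true⇒≡ {true} {false} a⇒b _ = sym (a⇒b refl)
true⇔true⇒≡ {true} {true} _ _ = refl

∨-true⁻ : ∀ a {b} → a ∨ b ≡ true → a ≡ true ⊎ b ≡ true
∨-true⁻ true _ = inj₁ refl
∨-true⁻ false b≡true = inj₂ b≡true

∨-∧-not-cancel : ∀ a b → (b ≡ true → a ≡ true) → b ∨ (a ∧ not b) ≡ a
∨-∧-not-cancel a false _ = ∧-identityʳ a
∨-∧-not-cancel a true b⇒a = sym (b⇒a refl)

∧-not-∨-cancel : ∀ a b → (b ≡ true → a ≡ false) → (b ∨ a) ∧ not b ≡ a
∧-not-∨-cancel a false _ = ∧-identityʳ a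
∧-not-∨-cancel a true b⇒¬a = sym (b⇒¬a refl)

x∈p─q⇒x∉q : ∀ {n} (p q : Subset n) {x : Fin n} → x ∈ p ─ q → x ∉ q
x∈p─q⇒x∉q (_ ∷ p) (true ∷ q) {Fin.zero} () _
x∈p─q⇒x∉q (_ ∷ p) (_ ∷ q) {Fin.suc x} (there x∈) (there x∈q) = x∈p─q⇒x∉q p q x∈ x∈q

module _ {n : ℕ} where

  ∈-tabulate⁻ : (h : Fin n → Bool) {i : Fin n} → i ∈ tabulate h → h i ≡ true
  ∈-tabulate⁻ h {i} i∈ = trans (sym (lookup∘tabulate h i)) ([]=⇒lookup i∈)

  ∈-tabulate⁺ : (h : Fin n → Bool) {i : Fin n} → h i ≡ true → i ∈ tabulate h
  ∈-tabulate⁺ h {i} hi = lookup⇒[]= i (tabulate h) (trans (lookup∘tabulate h i) hi)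

  ⊈⇒∃∉ : {p q : Subset n} → ¬ p ⊆ q → ∃ λ x → x ∈ p × x ∉ q
  ⊈⇒∃∉ {p} {q} p⊈q with any? (λ x → x ∈? p ×-dec ¬? (x ∈? q))
  ... | yes witness = witness
  ... | no none = ⊥-elim (p⊈q λ {x} x∈p → decidable-stable (x ∈? q) (λ x∉q → none (x , x∈p , x∉q)))

  ≢⊤⇒∃∉ : {p : Subset n} → p ≢ ⊤ → ∃ λ x → x ∉ p
  ≢⊤⇒∃∉ p≢⊤ with ⊈⇒∃∉ (λ ⊤⊆p → p≢⊤ (⊆-antisym ⊆⊤ ⊤⊆p))
  ... | x , _ , x∉p = x , x∉p

  ∈⊎∈∁ : (p : Subset n) (x : Fin n) → x ∈ p ⊎ x ∈ ∁ p
  ∈⊎∈∁ p x = x∈p∪q⁻ p (∁ p) (subst (x ∈_) (sym (p∪∁p≡⊤ p)) ∈⊤)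

  ∩∁-∪-inverse : {p q : Subset n} → p ⊆ q → q ∩ ∁ p ∪ p ≡ q
  ∩∁-∪-inverse {p} {q} p⊆q = ⊆-antisym
    (λ x∈ → [ proj₁ ∘ x∈p∩q⁻ q (∁ p) , p⊆q ] (x∈p∪q⁻ (q ∩ ∁ p) p x∈))
    (λ {x} x∈q → x∈p∪q⁺ (Sum.swap (Sum.map₂ (λ x∈∁p → x∈p∩q⁺ (x∈q , x∈∁p)) (∈⊎∈∁ p x))))

  ∪-∩∁-inverse : {p q : Subset n} → q ⊆ ∁ p → (q ∪ p) ∩ ∁ p ≡ q
  ∪-∩∁-inverse {p} {q} q⊆∁p = ⊆-antisym
    (λ x∈ → let x∈q∪p , x∈∁p = x∈p∩q⁻ (q ∪ p) (∁ p) x∈ in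
            [ id , (λ x∈p → contradiction x∈p (x∈∁p⇒x∉p x∈∁p)) ] (x∈p∪q⁻ q p x∈q∪p))
    (λ x∈q → x∈p∩q⁺ (x∈p∪q⁺ (inj₁ x∈q) , q⊆∁p x∈q))

  ∪-⊆-cancelʳ : {p q r : Subset n} → p ⊆ ∁ r → p ∪ r ⊆ q ∪ r → p ⊆ q
  ∪-⊆-cancelʳ {p} {q} {r} p⊆∁r p∪r⊆q∪r x∈p =
    [ id , (λ x∈r → contradiction x∈r (x∈∁p⇒x∉p (p⊆∁r x∈p))) ] (x∈p∪q⁻ q r (p∪r⊆q∪r (x∈p∪q⁺ (inj₁ x∈p))))

  ∩∁-⊆-cancelʳ : {p q r : Subset n} → r ⊆ q → p ∩ ∁ r ⊆ q ∩ ∁ r → p ⊆ q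
  ∩∁-⊆-cancelʳ {p} {q} {r} r⊆q p∖r⊆q∖r {x} x∈p =
    [ r⊆q , (λ x∈∁r → proj₁ (x∈p∩q⁻ q (∁ r) (p∖r⊆q∖r (x∈p∩q⁺ (x∈p , x∈∁r))))) ] (∈⊎∈∁ r x)

-- Faces are predicates on characteristic functions; the complexes at hand only see those
-- pointwise, which stands in for function extensionality.
Extensional : Complex → Set
Extensional K = ∀ {σ τ} → (∀ v → σ v ≡ τ v) → Face K σ → Face K τ

-- The singleton comes first so that insert Δ (inj₂ F) σ and σ agree on the y-vertices by computation.
insert : (K : Complex) → V K → (V K → Bool) → V K → Bool
insert K v ρ w = singleton K v w ∨ ρ w

module _ (K : Complex) where

  singleton-refl : ∀ v → singleton K v v ≡ true
  singleton-refl v = dec-true (decV K v v) refl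

  singleton-true⁻ : ∀ {v w} → singleton K v w ≡ true → v ≡ w
  singleton-true⁻ {v} {w} = does-true⇒ (decV K v w)

  insert-self : ∀ v ρ → insert K v ρ v ≡ true
  insert-self v ρ = cong (_∨ ρ v) (singleton-refl v)

  insert-⊇ : ∀ v ρ w → ρ w ≡ true → insert K v ρ w ≡ true
  insert-⊇ v ρ w ρw = trans (cong (singleton K v w ∨_) ρw) (∨-zeroʳ _)

  insert-true⁻ : ∀ v ρ w → insert K v ρ w ≡ true → v ≡ w ⊎ ρ w ≡ true
  insert-true⁻ v ρ w e = Sum.map₁ singleton-true⁻ (∨-true⁻ (singleton K v w) e)

  link-face⇔ : Extensional K → ∀ v ρ → Face (link K v) ρ ⇔ (ρ v ≡ false × Face K (insert K v ρ))
  link-face⇔ ext v ρ = mk⇔ ⇒ ⇐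
    where
      ⇒ : Face (link K v) ρ → ρ v ≡ false × Face K (insert K v ρ)
      ⇒ (τ , τ-face , τv , ρ≗τ-v) =
        trans (ρ≗τ-v v) (cong₂ (λ a b → a ∧ not b) τv (singleton-refl v)) ,
        ext τ≗insert τ-face
        where
          τ≗insert : ∀ w → τ w ≡ insert K v ρ w
          τ≗insert w = sym (trans (cong (singleton K v w ∨_) (ρ≗τ-v w))
            (∨-∧-not-cancel (τ w) (singleton K v w) (λ vw → subst (λ u → τ u ≡ true) (singleton-true⁻ vw) τv)))

      ⇐ : ρ v ≡ false × Face K (insert K v ρ) → Face (link K v) ρ
      ⇐ (ρv , face) = insert K v ρ , face , insert-self v ρ ,
        λ w → sym (∧-not-∨-cancel (ρ w) (singleton K v w) (λ vw → subst (λ u → ρ u ≡ false) (singleton-true⁻ vw) ρv))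

  link-vertex⇔ : Extensional K → ∀ v w → IsVertex (link K v) w ⇔ (w ≢ v × Face K (insert K v (singleton K w)))
  link-vertex⇔ ext v w = mk⇔
    (λ w∈ → let wv , face = to (link-face⇔ ext v (singleton K w)) w∈ in
            (λ w≡v → contradiction (trans (sym (dec-true (decV K w v) w≡v)) wv) λ ()) , face)
    (λ (w≢v , face) → from (link-face⇔ ext v (singleton K w)) (dec-false (decV K w v) w≢v , face))

module Join (K L : Complex) (extK : Extensional K) (extL : Extensional L) where

  join-face⇔ : ∀ ρ → Face (join K L) ρ ⇔ (Face K (ρ ∘ inj₁) × Face L (ρ ∘ inj₂))
  join-face⇔ ρ = mk⇔
    (λ (σ , τ , σ-face , τ-face , ρ≗σ⊎τ) →
       extK (sym ∘ ρ≗σ⊎τ ∘ inj₁) σ-face , extL (sym ∘ ρ≗σ⊎τ ∘ inj₂) τ-face)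
    (λ (σ-face , τ-face) → ρ ∘ inj₁ , ρ ∘ inj₂ , σ-face , τ-face , [ (λ _ → refl) , (λ _ → refl) ])

  join-vertex₁⇔ : Face L (λ _ → false) → ∀ a → IsVertex (join K L) (inj₁ a) ⇔ IsVertex K a
  join-vertex₁⇔ ∅-face a = mk⇔ (proj₁ ∘ to (join-face⇔ _)) (λ a∈ → from (join-face⇔ _) (a∈ , ∅-face))

  join-vertex₂⇔ : Face K (λ _ → false) → ∀ b → IsVertex (join K L) (inj₂ b) ⇔ IsVertex L b
  join-vertex₂⇔ ∅-face b = mk⇔ (proj₂ ∘ to (join-face⇔ _)) (λ b∈ → from (join-face⇔ _) (∅-face , b∈))

subsingleton-chain : ∀ {n} {c : Subset n → Bool} {G} → (∀ {H} → c H ≡ true → G ≡ H) → IsChain c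
subsingleton-chain only H H′ eH eH′ with only eH | only eH′
... | refl | refl = inj₁ ⊆-refl

module _ {n : ℕ} (S : Subset n) (g : Subset n → Subset n) where

  augBergman-extensional : Extensional (AugBergman S g)
  augBergman-extensional {σ} {σ′} σ≗σ′ (independent , flats , chain) =
    subst (IsIndependent S g) I≡I′ independent ,
    (λ G e → map₂ (subst (λ I → g I ⊆ G) I≡I′) (flats G (trans (σ≗σ′ (inj₂ G)) e))) ,
    (λ G H eG eH → chain G H (trans (σ≗σ′ (inj₂ G)) eG) (trans (σ≗σ′ (inj₂ H)) eH))
    where
      I≡I′ = tabulate-cong (σ≗σ′ ∘ inj₁)

  bergman-extensional : Extensional (Bergman S g)
  bergman-extensional σ≗σ′ (flats , chain) =
    (λ G e → flats G (trans (σ≗σ′ G) e)) ,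
    (λ G H eG eH → chain G H (trans (σ≗σ′ G) eG) (trans (σ≗σ′ H) eH))

  empty-independent : ∀ {I} → (∀ {j} → j ∉ I) → IsIndependent S g I
  empty-independent ∉I = (λ j∈I → contradiction j∈I ∉I) , (λ _ j∈I → contradiction j∈I ∉I)

  augBergman-empty-face : Face (AugBergman S g) (λ _ → false)
  augBergman-empty-face = empty-independent (λ j∈ → contradiction (∈-tabulate⁻ _ j∈) λ ()) , (λ _ ()) , (λ _ _ ())

  bergman-empty-face : Face (Bergman S g) (λ _ → false)
  bergman-empty-face = (λ _ ()) , (λ _ _ ())

  bergman-vertex⇔ : ∀ H → IsVertex (Bergman S g) H ⇔ (IsFlat S g H × g ∅ˢ ⊂ H × H ⊂ S)
  bergman-vertex⇔ H = mk⇔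
    (λ (flats , _) → flats H (singleton-refl (Bergman S g) H))
    (λ H-vertex → (λ G e → subst (λ X → IsFlat S g X × g ∅ˢ ⊂ X × X ⊂ S) (singleton-true⁻ (Bergman S g) e) H-vertex) ,
                  subsingleton-chain (singleton-true⁻ (Bergman S g) {H}))

module ClosureOperator {n : ℕ} {S : Subset n} {g : Subset n → Subset n} (cl : IsClosureOn S g) where
  open IsClosureOn cl

  Δ : Complex
  Δ = AugBergman S g

  closure⊆flat : ∀ {I G} → IsFlat S g G → I ⊆ G → g I ⊆ G
  closure⊆flat {I} {G} (G⊆S , gG≡G) I⊆G = subst (g I ⊆_) gG≡G (monotone I G (⊆-trans I⊆G G⊆S) G⊆S I⊆G)

  -- For a loop i, I ⊆ g (I - i), so removing i would not shrink the closure.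
  independent⇒nonloop : ∀ {I i} → IsIndependent S g I → i ∈ I → i ∉ g ∅ˢ
  independent⇒nonloop {I} {i} (I⊆S , strict) i∈I i∈g∅ with strict i i∈I
  ... | _ , x , x∈gI , x∉g[I-i] =
    x∉g[I-i] (subst (x ∈_) (idempotent (I - i) I-i⊆S) (monotone I (g (I - i)) I⊆S (closed (I - i) I-i⊆S) I⊆g[I-i] x∈gI))
    where
      I-i⊆S : I - i ⊆ S
      I-i⊆S = ⊆-trans (p─q⊆p I ⁅ i ⁆) I⊆S
      I⊆g[I-i] : I ⊆ g (I - i)
      I⊆g[I-i] {j} j∈I with j Fin.≟ i
      ... | yes refl = monotone ∅ˢ (I - i) ⊥⊆ I-i⊆S ⊥⊆ i∈g∅
      ... | no j≢i = extensive (I - i) I-i⊆S (x∈p∧x≢y⇒x∈p-y j∈I j≢i)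

  subsingleton-independent : ∀ {I i} → i ∈ S → i ∉ g ∅ˢ → (∀ {j} → j ∈ I → j ≡ i) → IsIndependent S g I
  subsingleton-independent {I} {i} i∈S i∉g∅ only = I⊆S , strict
    where
      I⊆S : I ⊆ S
      I⊆S j∈I = subst (_∈ S) (sym (only j∈I)) i∈S
      strict : ∀ j → j ∈ I → g (I - j) ⊂ g I
      strict j j∈I = monotone (I - j) I I-j⊆S I⊆S (p─q⊆p I ⁅ j ⁆) , j , extensive I I⊆S j∈I ,
                     λ j∈g[I-j] → i∉g∅ (subst (_∈ g ∅ˢ) (only j∈I) (monotone (I - j) ∅ˢ I-j⊆S ⊥⊆ I-j⊆∅ j∈g[I-j]))
        where
          I-j⊆S = ⊆-trans (p─q⊆p I ⁅ j ⁆) I⊆S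
          I-j⊆∅ : I - j ⊆ ∅ˢ
          I-j⊆∅ k∈ = contradiction (subst (_∈ ⁅ j ⁆) (trans (only j∈I) (sym (only (p─q⊆p I ⁅ j ⁆ k∈)))) (x∈⁅x⁆ j))
                                   (x∈p─q⇒x∉q I ⁅ j ⁆ k∈)

  y-vertex⇔ : ∀ i → IsVertex Δ (inj₁ i) ⇔ (i ∈ S × i ∉ g ∅ˢ)
  y-vertex⇔ i = mk⇔
    (λ (independent , _) → proj₁ independent i∈I , independent⇒nonloop independent i∈I)
    (λ (i∈S , i∉g∅) →
       subsingleton-independent i∈S i∉g∅ (λ j∈ → sym (inj₁-injective (singleton-true⁻ Δ (∈-tabulate⁻ (σ ∘ inj₁) j∈)))) ,
       (λ _ ()) , (λ _ _ ()))
    where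
      σ = singleton Δ (inj₁ i)
      i∈I = ∈-tabulate⁺ (σ ∘ inj₁) (singleton-refl Δ (inj₁ i))

  x-vertex⇔ : ∀ G → IsVertex Δ (inj₂ G) ⇔ IsProperFlat S g G
  x-vertex⇔ G = mk⇔
    (λ (_ , flats , _) → proj₁ (flats G (singleton-refl Δ (inj₂ G))))
    (λ G-proper →
       empty-independent S g ∉I ,
       (λ G′ e → subst (λ X → IsProperFlat S g X × g I ⊆ X) (is-G e)
                       (G-proper , closure⊆flat (proj₁ G-proper) (⊥-elim ∘ ∉I))) ,
       subsingleton-chain is-G)
    where
      σ = singleton Δ (inj₂ G)
      I = tabulate (σ ∘ inj₁)
      ∉I : ∀ {j} → j ∉ I
      ∉I j∈ = contradiction (∈-tabulate⁻ (σ ∘ inj₁) j∈) λ ()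
      is-G : ∀ {G′} → σ (inj₂ G′) ≡ true → G ≡ G′
      is-G = inj₂-injective ∘ singleton-true⁻ Δ

  yx-face⇔ : ∀ i G → Face Δ (insert Δ (inj₂ G) (singleton Δ (inj₁ i))) ⇔ (IsProperFlat S g G × i ∈ G × i ∉ g ∅ˢ)
  yx-face⇔ i G = mk⇔
    (λ (independent , flats , _) →
       let G-proper , gI⊆G = flats G (insert-self Δ (inj₂ G) (singleton Δ (inj₁ i))) in
       G-proper , gI⊆G (extensive I (proj₁ independent) i∈I) , independent⇒nonloop independent i∈I)
    (λ (G-proper , i∈G , i∉g∅) →
       subsingleton-independent (proj₁ (proj₁ G-proper) i∈G) i∉g∅ only ,
       (λ G′ e → subst (λ X → IsProperFlat S g X × g I ⊆ X) (is-G e)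
                       (G-proper , closure⊆flat (proj₁ G-proper) (λ j∈ → subst (_∈ G) (sym (only j∈)) i∈G))) ,
       subsingleton-chain is-G)
    where
      σ = insert Δ (inj₂ G) (singleton Δ (inj₁ i))
      I = tabulate (σ ∘ inj₁)
      i∈I = ∈-tabulate⁺ (σ ∘ inj₁) (singleton-refl Δ (inj₁ i))
      only : ∀ {j} → j ∈ I → j ≡ i
      only j∈ = sym (inj₁-injective (singleton-true⁻ Δ (∈-tabulate⁻ (σ ∘ inj₁) j∈)))
      is-G : ∀ {G′} → σ (inj₂ G′) ≡ true → G ≡ G′
      is-G {G′} e with insert-true⁻ Δ (inj₂ G) (singleton Δ (inj₁ i)) (inj₂ G′) e
      ... | inj₁ refl = refl
      ... | inj₂ ()

  xx-face⇔ : ∀ G H → Face Δ (insert Δ (inj₂ G) (singleton Δ (inj₂ H))) ⇔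
                     (IsProperFlat S g G × IsProperFlat S g H × (H ⊆ G ⊎ G ⊆ H))
  xx-face⇔ G H = mk⇔
    (λ (_ , flats , chain) → proj₁ (flats G G∈σ) , proj₁ (flats H H∈σ) , chain H G H∈σ G∈σ)
    (λ (G-proper , H-proper , comparable) →
       empty-independent S g ∉I ,
       flats G-proper H-proper ,
       λ X Y eX eY → chain comparable (G-or-H eX) (G-or-H eY))
    where
      σ = insert Δ (inj₂ G) (singleton Δ (inj₂ H))
      I = tabulate (σ ∘ inj₁)
      G∈σ = insert-self Δ (inj₂ G) (singleton Δ (inj₂ H))
      H∈σ = insert-⊇ Δ (inj₂ G) (singleton Δ (inj₂ H)) (inj₂ H) (singleton-refl Δ (inj₂ H))
      ∉I : ∀ {j} → j ∉ I
      ∉I j∈ = contradiction (∈-tabulate⁻ (σ ∘ inj₁) j∈) λ ()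
      G-or-H : ∀ {X} → σ (inj₂ X) ≡ true → G ≡ X ⊎ H ≡ X
      G-or-H {X} e = Sum.map inj₂-injective (inj₂-injective ∘ singleton-true⁻ Δ)
                             (insert-true⁻ Δ (inj₂ G) (singleton Δ (inj₂ H)) (inj₂ X) e)
      flats : IsProperFlat S g G → IsProperFlat S g H → ∀ X → σ (inj₂ X) ≡ true → IsProperFlat S g X × g I ⊆ X
      flats G-proper H-proper X e with G-or-H e
      ... | inj₁ refl = G-proper , closure⊆flat (proj₁ G-proper) (⊥-elim ∘ ∉I)
      ... | inj₂ refl = H-proper , closure⊆flat (proj₁ H-proper) (⊥-elim ∘ ∉I)
      chain : ∀ {X Y} → H ⊆ G ⊎ G ⊆ H → G ≡ X ⊎ H ≡ X → G ≡ Y ⊎ H ≡ Y → X ⊆ Y ⊎ Y ⊆ X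
      chain _ (inj₁ refl) (inj₁ refl) = inj₁ ⊆-refl
      chain comparable (inj₁ refl) (inj₂ refl) = Sum.swap comparable
      chain comparable (inj₂ refl) (inj₁ refl) = comparable
      chain _ (inj₂ refl) (inj₂ refl) = inj₁ ⊆-refl

module _ {n : ℕ} {f : Subset n → Subset n} (cl : IsClosureOn ⊤ f) {F : Subset n} (fF≡F : f F ≡ F) where
  open IsClosureOn cl

  restrict-isClosure : IsClosureOn F (restrict f F)
  restrict-isClosure = record
    { closed     = λ A A⊆F → ClosureOperator.closure⊆flat cl (⊆⊤ , fF≡F) A⊆F
    ; extensive  = λ A _ → extensive A ⊆⊤
    ; monotone   = λ A B _ _ → monotone A B ⊆⊤ ⊆⊤
    ; idempotent = λ A _ → idempotent A ⊆⊤
    }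

  contract-∅ : contract f F ∅ˢ ≡ ∅ˢ
  contract-∅ = begin
    f (∅ˢ ∪ F) ∩ ∁ F  ≡⟨ cong (λ X → f X ∩ ∁ F) (∪-identityˡ F) ⟩
    f F ∩ ∁ F         ≡⟨ cong (_∩ ∁ F) fF≡F ⟩
    F ∩ ∁ F           ≡⟨ ∩-inverseʳ F ⟩
    ∅ˢ                ∎
    where open ≡-Reasoning

  contract-flat⁺ : ∀ {G} → F ⊆ G → f G ≡ G → IsFlat (∁ F) (contract f F) (G ∩ ∁ F)
  contract-flat⁺ {G} F⊆G fG≡G = p∩q⊆q G (∁ F) , (begin
    f (G ∩ ∁ F ∪ F) ∩ ∁ F  ≡⟨ cong (λ X → f X ∩ ∁ F) (∩∁-∪-inverse F⊆G) ⟩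
    f G ∩ ∁ F              ≡⟨ cong (_∩ ∁ F) fG≡G ⟩
    G ∩ ∁ F                ∎)
    where open ≡-Reasoning

  contract-flat⁻ : ∀ {H} → IsFlat (∁ F) (contract f F) H → f (H ∪ F) ≡ H ∪ F
  contract-flat⁻ {H} (_ , f/F[H]≡H) = ⊆-antisym f[H∪F]⊆H∪F (extensive (H ∪ F) ⊆⊤)
    where
      f[H∪F]⊆H∪F : f (H ∪ F) ⊆ H ∪ F
      f[H∪F]⊆H∪F {x} x∈ =
        x∈p∪q⁺ (Sum.swap (Sum.map₂ (λ x∈∁F → subst (x ∈_) f/F[H]≡H (x∈p∩q⁺ (x∈ , x∈∁F))) (∈⊎∈∁ F x)))

  contract-vertex⁺ : ∀ {G} → IsProperFlat ⊤ f G → F ⊆ G → ¬ G ⊆ F → IsVertex (Bergman (∁ F) (contract f F)) (G ∩ ∁ F)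
  contract-vertex⁺ {G} ((_ , fG≡G) , G≢⊤) F⊆G G⊈F =
    from (bergman-vertex⇔ (∁ F) (contract f F) (G ∩ ∁ F)) (contract-flat⁺ F⊆G fG≡G , loops⊂ , ⊂∁F)
    where
      loops⊂ : contract f F ∅ˢ ⊂ G ∩ ∁ F
      loops⊂ with ⊈⇒∃∉ G⊈F
      ... | x , x∈G , x∉F = subst (_⊂ G ∩ ∁ F) (sym contract-∅) (⊥⊆ , x , x∈p∩q⁺ (x∈G , x∉p⇒x∈∁p x∉F) , ∉⊥)
      ⊂∁F : G ∩ ∁ F ⊂ ∁ F
      ⊂∁F with ≢⊤⇒∃∉ G≢⊤
      ... | y , y∉G = p∩q⊆q G (∁ F) , y , x∉p⇒x∈∁p (y∉G ∘ F⊆G) , y∉G ∘ proj₁ ∘ x∈p∩q⁻ G (∁ F)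

  contract-vertex⁻ : ∀ {H} → IsVertex (Bergman (∁ F) (contract f F)) H → IsProperFlat ⊤ f (H ∪ F) × ¬ H ∪ F ⊆ F
  contract-vertex⁻ {H} H-vertex with to (bergman-vertex⇔ (∁ F) (contract f F) H) H-vertex
  ... | H-flat , (_ , x , x∈H , _) , (_ , y , y∈∁F , y∉H) =
    ((⊆⊤ , contract-flat⁻ H-flat) , H∪F≢⊤) ,
    λ H∪F⊆F → x∈∁p⇒x∉p (proj₁ H-flat x∈H) (H∪F⊆F (x∈p∪q⁺ (inj₁ x∈H)))
    where
      H∪F≢⊤ : H ∪ F ≢ ⊤
      H∪F≢⊤ H∪F≡⊤ = [ y∉H , x∈∁p⇒x∉p y∈∁F ] (x∈p∪q⁻ H F (subst (y ∈_) (sym H∪F≡⊤) ∈⊤))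

module LinkOfFlat {n : ℕ} (f : Subset n → Subset n) (cl : IsClosureOn ⊤ f)
                  (F : Subset n) (F-proper : IsProperFlat ⊤ f F) where

  Δ K A B L : Complex
  Δ = AugBergman ⊤ f
  K = link Δ (inj₂ F)
  A = AugBergman F (restrict f F)
  B = Bergman (∁ F) (contract f F)
  L = join A B

  fF≡F : f F ≡ F
  fF≡F = proj₂ (proj₁ F-proper)

  module Δ = ClosureOperator cl
  module A = ClosureOperator (restrict-isClosure cl fF≡F)

  extΔ : Extensional Δ
  extΔ = augBergman-extensional ⊤ f

  open Join A B (augBergman-extensional F (restrict f F)) (bergman-extensional (∁ F) (contract f F))

  K-y-vertex⇔ : ∀ i → IsVertex K (inj₁ i) ⇔ (i ∈ F × i ∉ f ∅ˢ)
  K-y-vertex⇔ i = mk⇔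
    (λ i-vertex → proj₂ (to (Δ.yx-face⇔ i F) (proj₂ (to (link-vertex⇔ Δ extΔ (inj₂ F) (inj₁ i)) i-vertex))))
    (λ i∈F×i∉f∅ → from (link-vertex⇔ Δ extΔ (inj₂ F) (inj₁ i)) ((λ ()) , from (Δ.yx-face⇔ i F) (F-proper , i∈F×i∉f∅)))

  K-x-vertex⇔ : ∀ G → IsVertex K (inj₂ G) ⇔ (G ≢ F × IsProperFlat ⊤ f G × (G ⊆ F ⊎ F ⊆ G))
  K-x-vertex⇔ G = mk⇔
    (λ G-vertex → let G≢F , face = to (link-vertex⇔ Δ extΔ (inj₂ F) (inj₂ G)) G-vertex in
                  G≢F ∘ cong inj₂ , proj₂ (to (Δ.xx-face⇔ F G) face))
    (λ (G≢F , G-proper , comparable) →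
       from (link-vertex⇔ Δ extΔ (inj₂ F) (inj₂ G))
            (G≢F ∘ inj₂-injective , from (Δ.xx-face⇔ F G) (F-proper , G-proper , comparable)))

  L-y-vertex⇔ : ∀ i → IsVertex L (inj₁ (inj₁ i)) ⇔ (i ∈ F × i ∉ f ∅ˢ)
  L-y-vertex⇔ i = A.y-vertex⇔ i ⇔-∘ join-vertex₁⇔ (bergman-empty-face (∁ F) (contract f F)) (inj₁ i)

  L-x-vertex⇔ : ∀ G → IsVertex L (inj₁ (inj₂ G)) ⇔ IsProperFlat F f G
  L-x-vertex⇔ G = A.x-vertex⇔ G ⇔-∘ join-vertex₁⇔ (bergman-empty-face (∁ F) (contract f F)) (inj₂ G)

  L-B-vertex⇔ : ∀ H → IsVertex L (inj₂ H) ⇔ IsVertex B H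
  L-B-vertex⇔ = join-vertex₂⇔ (augBergman-empty-face F (restrict f F))

  -- A flat comparable with F is a flat of f|_F or, after removing F, a flat of f/F.
  φ-flat : (G : Subset n) → Dec (G ⊆ F) → V L
  φ-flat G (yes _) = inj₁ (inj₂ G)
  φ-flat G (no _) = inj₂ (G ∩ ∁ F)

  φ : V K → V L
  φ (inj₁ i) = inj₁ (inj₁ i)
  φ (inj₂ G) = φ-flat G (G ⊆? F)

  ψ : V L → V K
  ψ (inj₁ a) = a
  ψ (inj₂ H) = inj₂ (H ∪ F)

  φ-below : ∀ {G} → G ⊆ F → φ (inj₂ G) ≡ inj₁ (inj₂ G)
  φ-below {G} G⊆F with G ⊆? F
  ... | yes _ = refl
  ... | no G⊈F = ⊥-elim (G⊈F G⊆F)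

  φ-above : ∀ {G} → ¬ G ⊆ F → φ (inj₂ G) ≡ inj₂ (G ∩ ∁ F)
  φ-above {G} G⊈F with G ⊆? F
  ... | yes G⊆F = ⊥-elim (G⊈F G⊆F)
  ... | no _ = refl

  above-F : ∀ {G} → G ⊆ F ⊎ F ⊆ G → ¬ G ⊆ F → F ⊆ G
  above-F (inj₁ G⊆F) G⊈F = ⊥-elim (G⊈F G⊆F)
  above-F (inj₂ F⊆G) _ = F⊆G

  φ-vertex : ∀ v → IsVertex K v → IsVertex L (φ v) × ψ (φ v) ≡ v
  φ-vertex (inj₁ i) i-vertex = from (L-y-vertex⇔ i) (to (K-y-vertex⇔ i) i-vertex) , refl
  φ-vertex (inj₂ G) G-vertex with to (K-x-vertex⇔ G) G-vertex | G ⊆? F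
  ... | G≢F , G-proper , _ | yes G⊆F =
    from (L-x-vertex⇔ G) ((G⊆F , proj₂ (proj₁ G-proper)) , G≢F) , refl
  ... | _ , G-proper , comparable | no G⊈F =
    from (L-B-vertex⇔ _) (contract-vertex⁺ cl fF≡F G-proper (above-F comparable G⊈F) G⊈F) ,
    cong inj₂ (∩∁-∪-inverse (above-F comparable G⊈F))

  ψ-vertex : ∀ w → IsVertex L w → IsVertex K (ψ w) × φ (ψ w) ≡ w
  ψ-vertex (inj₁ (inj₁ i)) i-vertex = from (K-y-vertex⇔ i) (to (L-y-vertex⇔ i) i-vertex) , refl
  ψ-vertex (inj₁ (inj₂ G)) G-vertex with to (L-x-vertex⇔ G) G-vertex
  ... | (G⊆F , fG≡G) , G≢F = from (K-x-vertex⇔ G) (G≢F , ((⊆⊤ , fG≡G) , G≢⊤) , inj₁ G⊆F) , φ-below G⊆F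
    where
      G≢⊤ : G ≢ ⊤
      G≢⊤ refl = proj₂ F-proper (⊆-antisym ⊆⊤ G⊆F)
  ψ-vertex (inj₂ H) H-vertex with to (L-B-vertex⇔ H) H-vertex
  ... | H-vertexᴮ with contract-vertex⁻ cl fF≡F H-vertexᴮ
  ...   | H∪F-proper , H∪F⊈F =
    from (K-x-vertex⇔ (H ∪ F)) (H∪F⊈F ∘ ⊆-reflexive , H∪F-proper , inj₂ (q⊆p∪q H F)) ,
    trans (φ-above H∪F⊈F) (cong inj₂ (∪-∩∁-inverse H⊆∁F))
    where
      H⊆∁F : H ⊆ ∁ F
      H⊆∁F = proj₁ (proj₁ (to (bergman-vertex⇔ (∁ F) (contract f F) H) H-vertexᴮ))

  module FaceTransfer (σ : V K → Bool) (τ : V L → Bool) (σ-supported : Supported K σ) (τ-supported : Supported L τ)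
                      (agree : ∀ v → IsVertex K v → σ v ≡ τ (φ v)) where

    σ⇒τ∘φ : ∀ {v} → σ v ≡ true → τ (φ v) ≡ true
    σ⇒τ∘φ {v} e = trans (sym (agree v (σ-supported v e))) e

    τ⇒σ∘ψ : ∀ {w} → τ w ≡ true → σ (ψ w) ≡ true
    τ⇒σ∘ψ {w} e = let ψw-vertex , φψw≡w = ψ-vertex w (τ-supported w e) in
                  trans (agree (ψ w) ψw-vertex) (trans (cong τ φψw≡w) e)

    σ⁺ : V K → Bool
    σ⁺ = insert Δ (inj₂ F) σ

    I : Subset n
    I = tabulate (σ ∘ inj₁)

    I≡Iᴬ : I ≡ tabulate (τ ∘ inj₁ ∘ inj₁)
    I≡Iᴬ = tabulate-cong (λ i → true⇔true⇒≡ σ⇒τ∘φ τ⇒σ∘ψ)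

    K⇒L : Face K σ → Face L τ
    K⇒L σ-face with to (link-face⇔ Δ extΔ (inj₂ F) σ) σ-face
    ... | _ , independent , flats , chain = from (join-face⇔ τ) (A-face , B-face)
      where
        τ⇒σ⁺∘ψ : ∀ {w} → τ w ≡ true → σ⁺ (ψ w) ≡ true
        τ⇒σ⁺∘ψ {w} e = insert-⊇ Δ (inj₂ F) σ (ψ w) (τ⇒σ∘ψ e)

        I⊆F : I ⊆ F
        I⊆F i∈I = proj₂ (flats F (insert-self Δ (inj₂ F) σ)) (IsClosureOn.extensive cl I ⊆⊤ i∈I)

        A-face : Face A (τ ∘ inj₁)
        A-face =
          subst (IsIndependent F f) I≡Iᴬ (I⊆F , proj₂ independent) ,
          (λ G e → to (L-x-vertex⇔ G) (τ-supported _ e) , subst (λ J → f J ⊆ G) I≡Iᴬ (proj₂ (flats G (τ⇒σ⁺∘ψ e)))) ,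
          (λ G G′ e e′ → chain G G′ (τ⇒σ⁺∘ψ e) (τ⇒σ⁺∘ψ e′))

        B-vertex : ∀ {H} → τ (inj₂ H) ≡ true → IsVertex B H
        B-vertex e = to (L-B-vertex⇔ _) (τ-supported _ e)

        B-face : Face B (τ ∘ inj₂)
        B-face =
          (λ H e → to (bergman-vertex⇔ (∁ F) (contract f F) H) (B-vertex e)) ,
          (λ H H′ e e′ → Sum.map (∪-⊆-cancelʳ (H⊆∁F e)) (∪-⊆-cancelʳ (H⊆∁F e′))
                                 (chain (H ∪ F) (H′ ∪ F) (τ⇒σ⁺∘ψ e) (τ⇒σ⁺∘ψ e′)))
          where
            H⊆∁F : ∀ {H} → τ (inj₂ H) ≡ true → H ⊆ ∁ F
            H⊆∁F {H} e = proj₁ (proj₁ (to (bergman-vertex⇔ (∁ F) (contract f F) H) (B-vertex e)))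

    data Position (G : Subset n) : Set where
      at    : G ≡ F → Position G
      below : G ⊆ F → τ (inj₁ (inj₂ G)) ≡ true → Position G
      above : F ⊆ G → τ (inj₂ (G ∩ ∁ F)) ≡ true → Position G

    position : ∀ G → σ⁺ (inj₂ G) ≡ true → Position G
    position G e with insert-true⁻ Δ (inj₂ F) σ (inj₂ G) e
    ... | inj₁ F≡G = at (sym (inj₂-injective F≡G))
    ... | inj₂ σG with G ⊆? F | σ⇒τ∘φ {inj₂ G} σG
    ...   | yes G⊆F | τG = below G⊆F τG
    ...   | no G⊈F | τG = above (above-F (proj₂ (proj₂ (to (K-x-vertex⇔ G) (σ-supported _ σG)))) G⊈F) τG

    L⇒K : Face L τ → Face K σ
    L⇒K τ-face with to (join-face⇔ τ) τ-face
    ... | (independentᴬ , flatsᴬ , chainᴬ) , (_ , chainᴮ) =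
      from (link-face⇔ Δ extΔ (inj₂ F) σ)
           (σF≡false , independent , flats , λ G G′ e e′ → comparable (position G e) (position G′ e′))
      where
        σF≡false : σ (inj₂ F) ≡ false
        σF≡false = ≢true⇒≡false (λ e → proj₁ (to (K-x-vertex⇔ F) (σ-supported _ e)) refl)

        independent : IsIndependent ⊤ f I
        independent = subst (IsIndependent ⊤ f) (sym I≡Iᴬ) (⊆⊤ , proj₂ independentᴬ)

        fI⊆F : f I ⊆ F
        fI⊆F = Δ.closure⊆flat (proj₁ F-proper) (λ i∈I → proj₁ independentᴬ (subst (_ ∈_) I≡Iᴬ i∈I))

        fI⊆ : ∀ {G} → Position G → f I ⊆ G
        fI⊆ (at refl) = fI⊆F
        fI⊆ {G} (below _ τG) = subst (λ J → f J ⊆ G) (sym I≡Iᴬ) (proj₂ (flatsᴬ G τG))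
        fI⊆ (above F⊆G _) x∈ = F⊆G (fI⊆F x∈)

        flats : ∀ G → σ⁺ (inj₂ G) ≡ true → IsProperFlat ⊤ f G × f I ⊆ G
        flats G e with insert-true⁻ Δ (inj₂ F) σ (inj₂ G) e
        ... | inj₁ refl = F-proper , fI⊆F
        ... | inj₂ σG = proj₁ (proj₂ (to (K-x-vertex⇔ G) (σ-supported _ σG))) , fI⊆ (position G e)

        comparable : ∀ {G G′} → Position G → Position G′ → G ⊆ G′ ⊎ G′ ⊆ G
        comparable (at refl) (at refl) = inj₁ ⊆-refl
        comparable (at refl) (below G′⊆F _) = inj₂ G′⊆F
        comparable (at refl) (above F⊆G′ _) = inj₁ F⊆G′
        comparable (below G⊆F _) (at refl) = inj₁ G⊆F
        comparable (below _ τG) (below _ τG′) = chainᴬ _ _ τG τG′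
        comparable (below G⊆F _) (above F⊆G′ _) = inj₁ (⊆-trans G⊆F F⊆G′)
        comparable (above F⊆G _) (at refl) = inj₂ F⊆G
        comparable (above F⊆G _) (below G′⊆F _) = inj₂ (⊆-trans G′⊆F F⊆G)
        comparable (above F⊆G τG) (above F⊆G′ τG′) =
          Sum.map (∩∁-⊆-cancelʳ F⊆G′) (∩∁-⊆-cancelʳ F⊆G) (chainᴮ _ _ τG τG′)

  link≅join : K ≅ L
  link≅join = φ , ψ , φ-vertex , ψ-vertex , λ σ τ σ-supported τ-supported agree →
    let open FaceTransfer σ τ σ-supported τ-supported agree in mk⇔ K⇒L L⇒K

lemma2p2 : (n : ℕ) (f : Subset n → Subset n) → IsClosureOn ⊤ f →
           (F : Subset n) → IsProperFlat ⊤ f F →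
           link (AugBergman ⊤ f) (inj₂ F)
             ≅ join (AugBergman F (restrict f F)) (Bergman (∁ F) (contract f F))
lemma2p2 n f cl F F-proper = LinkOfFlat.link≅join f cl F F-proper
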